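{- Let $k\ge2$ and $n\ge1$ be integers. Then \[F\!\left(\frac{k^{n}-1}{k-1},\,k\right)=\frac{\big(k(n-1)-n-1\big)k^{n}+k(n+1)-n+1}{(k-1)^3}.\]
   Context: Fix an integer $k\ge 2$. Let $T_k$ be the infinite rooted $k$-ary tree (every vertex has exactly $k$ children) with one additional self-loop at the root, so every vertex has degree $k+1$. Chip-firing: a vertex with at least $k+1$ chips may fire, sending one chip along each incident edge (a non-root vertex sends one chip to its parent and one to each of its $k$ children; the root sends one chip to each of its $k$ children and one chip to itself along the self-loop). Starting with $N$ chips at the root and none elsewhere, vertices fire until no vertex can fire; this terminates, and the number of times each vertex fires does not depend on the order of firings. $F(N,k)$ denotes the total number of fires summed over all vertices. -}

module Defs where

open import Data.Nat using (ℕ; zero; suc; _+_; _*_; _∸_; _^_; _≤_; _<_; s≤s; z≤n; NonZero; >-nonZero)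
open import Data.Nat.DivMod using (_/_)
open import Data.Fin using (Fin)
import Data.Fin as Fin
open import Data.List using (List; []; _∷_; length)
open import Data.List.Properties using (≡-dec)
open import Data.Product using (Σ; _×_; _,_)
open import Relation.Nullary using (yes; no; Dec)
open import Relation.Binary.PropositionalEquality using (_≡_)

-- A vertex of the infinite rooted k-ary tree T_k: the path from the root,
-- written with the most recent step first.  [] is the root; the children
-- of v are (j ∷ v) for j : Fin k; the parent of (i ∷ u) is u.
Vertex : ℕ → Set
Vertex k = List (Fin k)

root : ∀ {k} → Vertex k
root = []

_≟v_ : ∀ {k} (v w : Vertex k) → Dec (v ≡ w)
_≟v_ = ≡-dec Fin._≟_

Config : ℕ → Set
Config k = Vertex k → ℕ

-- number of chips vertex w receives when v fires (along edges of T_k,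
-- including the self-loop at the root)
received : ∀ {k} → Vertex k → Vertex k → ℕ
received [] [] = 1
received v (j ∷ u) with u ≟v v
... | yes _ = 1
... | no _ = parentPart v (j ∷ u)
  where
  parentPart : ∀ {k} → Vertex k → Vertex k → ℕ
  parentPart [] _ = 0
  parentPart (i ∷ p) w with p ≟v w
  ... | yes _ = 1
  ... | no _ = 0
received (i ∷ p) [] with p ≟v []
... | yes _ = 1
... | no _ = 0

fire : ∀ {k} → Vertex k → Config k → Config k
fire {k} v c w with v ≟v w
... | yes _ = (c w ∸ suc k) + received v w
... | no _ = c w + received v w

CanFire : ∀ {k} → Config k → Vertex k → Set
CanFire {k} c v = suc k ≤ c v

Stable : ∀ {k} → Config k → Set
Stable {k} c = ∀ v → c v < suc k

data Legal {k : ℕ} : Config k → List (Vertex k) → Config k → Set where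
  done : ∀ {c} → Legal c [] c
  step : ∀ {c v vs c'} → CanFire c v → Legal (fire v c) vs c' → Legal c (v ∷ vs) c'

initial : ∀ k → ℕ → Config k
initial k N [] = N
initial k N (_ ∷ _) = 0

CompleteRun : (k N t : ℕ) → Set
CompleteRun k N t =
  Σ (List (Vertex k)) λ vs → Σ (Config k) λ c' →
    Legal (initial k N) vs c' × Stable c' × length vs ≡ t

pred-nonZero : ∀ {k} → 2 ≤ k → NonZero (k ∸ 1)
pred-nonZero (s≤s (s≤s {n = m} _)) = >-nonZero {suc m} (s≤s z≤n)

geomN : (k n : ℕ) → 2 ≤ k → ℕ
geomN k n hk = _/_ ((k ^ n) ∸ 1) (k ∸ 1) {{pred-nonZero hk}}

{-# OPTIONS --safe #-}
-- By the least action principle, a legal firing sequence is never longer than any multiset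
-- of firings that leads to a stable configuration, so all stabilising sequences from the
-- initial pile have the same length and it suffices to count one of them.  Along the one we
-- choose every configuration is constant on the levels of the tree, so it is a depth profile
-- ℕ → ℕ, and firing a whole level acts on profiles like chip-firing on a weighted path.
-- Write R j = 1 + k + ⋯ + k^(j-1), so N = R n.  When depth p holds 1 + r·k chips and every
-- shallower depth one chip, r waves, each firing the levels p, p-1, …, 0 once (R (p+1)
-- firings), leave one chip at depth p and r more chips at depth p + 1.  Starting from R n
-- chips at the root this gives F = Σ_{p<n} R (n-1-p) · R (p+1), whose closed form is the
-- stated polynomial.
module Submission where

open import Defs
open import Data.Nat using (ℕ; _≤_)
open import Data.Product using (Σ; _×_)
open import Relation.Binary.PropositionalEquality using (_≡_)

module Counting where

  open import Data.Bool using (if_then_else_)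
  open import Data.Empty using (⊥-elim)
  open import Data.Fin using (Fin; zero; suc; _≟_)
  open import Data.List using (List; []; _∷_; _++_; map; concatMap; length; allFin)
  open import Data.List.Properties using (length-++; map-++; map-∘; map-cong; map-tabulate)
  open import Data.List.Relation.Binary.Permutation.Propositional using (_↭_)
  open import Data.List.Relation.Binary.Permutation.Propositional.Properties using (map⁺)
  open import Data.Nat using (suc; _+_; _*_; z≤n)
  open import Data.Nat.ListAction using (sum)
  open import Data.Nat.ListAction.Properties using (sum-++; sum-↭)
  open import Data.Nat.Properties using (+-commutativeSemigroup; +-identityʳ; *-distribʳ-+; *-suc; *-zeroʳ)
  open import Algebra.Properties.CommutativeSemigroup +-commutativeSemigroup using (interchange)
  open import Function using (id; _∘_)
  open import Relation.Binary.PropositionalEquality using (refl; sym; trans; cong; subst)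
  open import Relation.Nullary using (Dec; yes; no; does; ¬_; _×-dec_)

  private variable
    A B : Set

  ∑-syntax : List A → (A → ℕ) → ℕ
  ∑-syntax xs g = sum (map g xs)

  infix 5 ∑-syntax
  syntax ∑-syntax xs (λ x → g) = ∑[ x ∈ xs ] g

  ∑-++ : ∀ xs ys (g : A → ℕ) → ∑[ x ∈ xs ++ ys ] g x ≡ (∑[ x ∈ xs ] g x) + (∑[ x ∈ ys ] g x)
  ∑-++ xs ys g = trans (cong sum (map-++ g xs ys)) (sum-++ (map g xs) (map g ys))

  ∑-map : ∀ (f : A → B) xs (g : B → ℕ) → ∑[ y ∈ map f xs ] g y ≡ ∑[ x ∈ xs ] g (f x)
  ∑-map f xs g = cong sum (sym (map-∘ xs))

  ∑-concatMap : ∀ (f : A → List B) xs (g : B → ℕ) →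
                ∑[ y ∈ concatMap f xs ] g y ≡ ∑[ x ∈ xs ] (∑[ y ∈ f x ] g y)
  ∑-concatMap f []       g = refl
  ∑-concatMap f (x ∷ xs) g = trans (∑-++ (f x) (concatMap f xs) g) (cong (_ +_) (∑-concatMap f xs g))

  ∑-cong : ∀ xs {g h : A → ℕ} → (∀ x → g x ≡ h x) → ∑[ x ∈ xs ] g x ≡ ∑[ x ∈ xs ] h x
  ∑-cong xs g≗h = cong sum (map-cong g≗h xs)

  ∑-↭ : ∀ {xs ys} (g : A → ℕ) → xs ↭ ys → ∑[ x ∈ xs ] g x ≡ ∑[ x ∈ ys ] g x
  ∑-↭ g xs↭ys = sum-↭ (map⁺ g xs↭ys)

  ∑-+ : ∀ xs (g h : A → ℕ) → ∑[ x ∈ xs ] (g x + h x) ≡ (∑[ x ∈ xs ] g x) + (∑[ x ∈ xs ] h x)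
  ∑-+ []       g h = refl
  ∑-+ (x ∷ xs) g h =
    trans (cong (g x + h x +_) (∑-+ xs g h)) (interchange (g x) (h x) _ _)

  ∑-*ʳ : ∀ xs (g : A → ℕ) c → ∑[ x ∈ xs ] (g x * c) ≡ (∑[ x ∈ xs ] g x) * c
  ∑-*ʳ []       g c = refl
  ∑-*ʳ (x ∷ xs) g c = trans (cong (g x * c +_) (∑-*ʳ xs g c)) (sym (*-distribʳ-+ c (g x) _))

  ∑-const : ∀ (xs : List A) c → ∑[ x ∈ xs ] c ≡ c * length xs
  ∑-const []       c = sym (*-zeroʳ c)
  ∑-const (x ∷ xs) c = trans (cong (c +_) (∑-const xs c)) (sym (*-suc c (length xs)))

  length-concatMap : ∀ (f : A → List B) xs → length (concatMap f xs) ≡ ∑[ x ∈ xs ] length (f x)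
  length-concatMap f []       = refl
  length-concatMap f (x ∷ xs) = trans (length-++ (f x)) (cong (length (f x) +_) (length-concatMap f xs))

  ∑-allFin-suc : ∀ {n} (g : Fin (suc n) → ℕ) →
                 ∑[ i ∈ allFin (suc n) ] g i ≡ g zero + (∑[ i ∈ allFin n ] g (suc i))
  ∑-allFin-suc g =
    cong (λ xs → g zero + sum xs) (trans (map-tabulate suc g) (sym (map-tabulate id (g ∘ suc))))

  𝟙 : {P : Set} → Dec P → ℕ
  𝟙 P? = if does P? then 1 else 0

  𝟙-yes : ∀ {P : Set} (P? : Dec P) → P → 𝟙 P? ≡ 1
  𝟙-yes (yes _) _ = refl
  𝟙-yes (no ¬p) p = ⊥-elim (¬p p)

  𝟙-no : ∀ {P : Set} (P? : Dec P) → ¬ P → 𝟙 P? ≡ 0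
  𝟙-no (yes p) ¬p = ⊥-elim (¬p p)
  𝟙-no (no _)  _  = refl

  𝟙-× : ∀ {P Q : Set} (P? : Dec P) (Q? : Dec Q) → 𝟙 (P? ×-dec Q?) ≡ 𝟙 P? * 𝟙 Q?
  𝟙-× (yes _) Q? = sym (+-identityʳ (𝟙 Q?))
  𝟙-× (no _)  Q? = refl

  𝟙-*-≤ : ∀ {P : Set} {n m} (P? : Dec P) → (P → n ≤ m) → 𝟙 P? * n ≤ m
  𝟙-*-≤ (yes p) n≤m = subst (_≤ _) (sym (+-identityʳ _)) (n≤m p)
  𝟙-*-≤ (no _)  _   = z≤n

  ∑-allFin-𝟙 : ∀ {n} (j : Fin n) → ∑[ i ∈ allFin n ] 𝟙 (i ≟ j) ≡ 1
  ∑-allFin-𝟙 {suc n} zero    =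
    trans (∑-allFin-suc {n} (λ i → 𝟙 (i ≟ zero))) (cong suc (∑-const (allFin n) 0))
  ∑-allFin-𝟙 {suc n} (suc j) =
    trans (∑-allFin-suc {n} (λ i → 𝟙 (i ≟ suc j))) (∑-allFin-𝟙 j)

module ChipFiring {k : ℕ} where

  open import Data.Empty using (⊥-elim)
  open import Data.List using (List; []; _∷_; _++_; length)
  open import Data.List.Membership.Propositional using (_∈_)
  open import Data.List.Membership.Propositional.Properties using (∈-∃++)
  open import Data.List.Relation.Unary.Any using (here; there)
  open import Data.List.Relation.Binary.Permutation.Propositional using (_↭_)
  open import Data.List.Relation.Binary.Permutation.Propositional.Properties using (shift; ↭-length)
  open import Data.Nat using (suc; _+_; _*_; _∸_; z≤n; s≤s)
  open import Data.Nat.Properties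
    using (+-commutativeSemigroup; +-comm; +-assoc; +-identityʳ; *-identityˡ; *-distribʳ-+;
           ≤-antisym; m≤m+n; m∸n+n≡m; <⇒≱; +-cancelʳ-≡; +-cancelʳ-≤; module ≤-Reasoning)
  open import Algebra.Properties.CommutativeSemigroup +-commutativeSemigroup using (xy∙z≈xz∙y; x∙yz≈xz∙y)
  open import Data.Product using (∃-syntax; _,_)
  open import Relation.Binary.PropositionalEquality using (_≢_; refl; sym; trans; cong; subst; module ≡-Reasoning)
  open import Relation.Nullary using (yes; no)
  open Counting

  mult : Vertex k → List (Vertex k) → ℕ
  mult w vs = ∑[ v ∈ vs ] 𝟙 (v ≟v w)

  inflow : List (Vertex k) → Vertex k → ℕ
  inflow vs w = ∑[ v ∈ vs ] received v w

  -- c′ = c − Δ·vs: firing the multiset vs in c, regardless of legality, leaves c′.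
  record Balanced (c : Config k) (vs : List (Vertex k)) (c′ : Config k) : Set where
    constructor balanced
    field balance : ∀ w → c′ w + mult w vs * suc k ≡ c w + inflow vs w
  open Balanced public

  fire-balance : ∀ {c} v w → CanFire c v → fire v c w + 𝟙 (v ≟v w) * suc k ≡ c w + received v w
  fire-balance {c} v w cf with v ≟v w
  ... | yes refl = begin
    c v ∸ suc k + received v v + 1 * suc k  ≡⟨ cong (c v ∸ suc k + received v v +_) (*-identityˡ _) ⟩
    c v ∸ suc k + received v v + suc k      ≡⟨ xy∙z≈xz∙y (c v ∸ suc k) _ _ ⟩
    c v ∸ suc k + suc k + received v v      ≡⟨ cong (_+ received v v) (m∸n+n≡m cf) ⟩
    c v + received v v                      ∎
    where open ≡-Reasoning
  ... | no _ = +-identityʳ _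

  mult-∷-shift : ∀ x v vs w →
                 x + mult w (v ∷ vs) * suc k ≡ (x + mult w vs * suc k) + 𝟙 (v ≟v w) * suc k
  mult-∷-shift x v vs w = trans (cong (x +_) (*-distribʳ-+ (suc k) (𝟙 (v ≟v w)) _)) (x∙yz≈xz∙y x _ _)

  inflow-∷-shift : ∀ {c} v vs w → CanFire c v →
                   c w + inflow (v ∷ vs) w ≡ (fire v c w + inflow vs w) + 𝟙 (v ≟v w) * suc k
  inflow-∷-shift {c} v vs w cf = begin
    c w + (received v w + inflow vs w)             ≡⟨ +-assoc (c w) _ _ ⟨
    c w + received v w + inflow vs w               ≡⟨ cong (_+ inflow vs w) (fire-balance v w cf) ⟨
    fire v c w + 𝟙 (v ≟v w) * suc k + inflow vs w  ≡⟨ xy∙z≈xz∙y (fire v c w) _ _ ⟩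
    fire v c w + inflow vs w + 𝟙 (v ≟v w) * suc k  ∎
    where open ≡-Reasoning

  Balanced-∷ : ∀ {c v vs c′} → CanFire c v → Balanced (fire v c) vs c′ → Balanced c (v ∷ vs) c′
  Balanced-∷ {v = v} {vs} {c′} cf bal = balanced λ w →
    trans (mult-∷-shift (c′ w) v vs w)
          (trans (cong (_+ 𝟙 (v ≟v w) * suc k) (balance bal w)) (sym (inflow-∷-shift v vs w cf)))

  Balanced-∷⁻ : ∀ {c v vs c′} → CanFire c v → Balanced c (v ∷ vs) c′ → Balanced (fire v c) vs c′
  Balanced-∷⁻ {v = v} {vs} {c′} cf bal = balanced λ w → +-cancelʳ-≡ _ _ _
    (trans (sym (mult-∷-shift (c′ w) v vs w)) (trans (balance bal w) (inflow-∷-shift v vs w cf)))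

  Balanced-↭ : ∀ {c vs ws c′} → vs ↭ ws → Balanced c vs c′ → Balanced c ws c′
  Balanced-↭ {c} {c′ = c′} vs↭ws bal = balanced λ w →
    trans (cong (λ m → c′ w + m * suc k) (sym (∑-↭ _ vs↭ws)))
          (trans (balance bal w) (cong (c w +_) (∑-↭ _ vs↭ws)))

  legal-balance : ∀ {c vs c′} → Legal c vs c′ → Balanced c vs c′
  legal-balance done        = balanced λ _ → refl
  legal-balance (step cf L) = Balanced-∷ cf (legal-balance L)

  Legal-++ : ∀ {c : Config k} {xs c₁ ys c₂} → Legal c xs c₁ → Legal c₁ ys c₂ → Legal c (xs ++ ys) c₂
  Legal-++ done        L₂ = L₂
  Legal-++ (step cf L) L₂ = step cf (Legal-++ L L₂)

  legal-of-enough-chips : ∀ vs {c} → (∀ w → mult w vs * suc k ≤ c w) → ∃[ c′ ] Legal c vs c′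
  legal-of-enough-chips []       enough = _ , done
  legal-of-enough-chips (v ∷ vs) {c} enough =
    let c′ , L = legal-of-enough-chips vs enough′ in c′ , step cf L
    where
    open ≤-Reasoning

    cf : CanFire c v
    cf = begin
      suc k                    ≤⟨ m≤m+n (suc k) _ ⟩
      (1 + mult v vs) * suc k  ≡⟨ cong (λ i → (i + mult v vs) * suc k) (𝟙-yes (v ≟v v) refl) ⟨
      mult v (v ∷ vs) * suc k  ≤⟨ enough v ⟩
      c v                      ∎

    enough′ : ∀ w → mult w vs * suc k ≤ fire v c w
    enough′ w = +-cancelʳ-≤ (𝟙 (v ≟v w) * suc k) _ _ (begin
      mult w vs * suc k + 𝟙 (v ≟v w) * suc k  ≡⟨ +-comm (mult w vs * suc k) _ ⟩
      𝟙 (v ≟v w) * suc k + mult w vs * suc k  ≡⟨ *-distribʳ-+ (suc k) (𝟙 (v ≟v w)) _ ⟨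
      mult w (v ∷ vs) * suc k                 ≤⟨ enough w ⟩
      c w                                     ≤⟨ m≤m+n (c w) _ ⟩
      c w + received v w                      ≡⟨ fire-balance v w cf ⟨
      fire v c w + 𝟙 (v ≟v w) * suc k         ∎)

  mult≢0⇒∈ : ∀ {w} vs → mult w vs ≢ 0 → w ∈ vs
  mult≢0⇒∈     []       m≢0 = ⊥-elim (m≢0 refl)
  mult≢0⇒∈ {w} (v ∷ vs) m≢0 with v ≟v w
  ... | yes refl = here refl
  ... | no _     = there (mult≢0⇒∈ vs m≢0)

  loaded-vertex-fires : ∀ {c β c₂ v} → Balanced c β c₂ → Stable c₂ → CanFire c v → v ∈ β
  loaded-vertex-fires {c} {β} {c₂} {v} bal stable cf = mult≢0⇒∈ β unfired-impossible
    where
    unfired-impossible : mult v β ≢ 0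
    unfired-impossible m≡0 = <⇒≱ (stable v) (begin
      suc k                    ≤⟨ cf ⟩
      c v                      ≤⟨ m≤m+n (c v) _ ⟩
      c v + inflow β v         ≡⟨ balance bal v ⟨
      c₂ v + mult v β * suc k  ≡⟨ cong (λ m → c₂ v + m * suc k) m≡0 ⟩
      c₂ v + 0                 ≡⟨ +-identityʳ (c₂ v) ⟩
      c₂ v                     ∎)
      where open ≤-Reasoning

  least-action : ∀ {c α c₁ β c₂} → Legal c α c₁ → Balanced c β c₂ → Stable c₂ → length α ≤ length β
  least-action done _ _ = z≤n
  least-action {β = β} (step {v = v} cf L) bal stable
    with ys , zs , refl ← ∈-∃++ (loaded-vertex-fires {β = β} {v = v} bal stable cf) =
    subst (_ ≤_) (sym (↭-length β↭))
          (s≤s (least-action L (Balanced-∷⁻ cf (Balanced-↭ β↭ bal)) stable))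
    where
    β↭ : ys ++ v ∷ zs ↭ v ∷ ys ++ zs
    β↭ = shift v ys zs

  stabilising-runs-have-equal-length : ∀ {c α c₁ β c₂} →
    Legal c α c₁ → Stable c₁ → Legal c β c₂ → Stable c₂ → length α ≡ length β
  stabilising-runs-have-equal-length Lα S₁ Lβ S₂ =
    ≤-antisym (least-action Lα (legal-balance Lβ) S₂) (least-action Lβ (legal-balance Lα) S₁)

module Levels (k : ℕ) where

  import Data.Fin as Fin
  open import Data.List using (List; []; _∷_; [_]; map; concatMap; length; allFin)
  open import Data.List.Properties using (length-map; length-tabulate)
  open import Data.Nat using (zero; suc; _+_; _*_; _^_)
  open import Data.Nat.Properties using (_≟_; *-identityˡ; m≢1+n+m)
  open import Function using (id; _∘_)
  open import Relation.Binary.PropositionalEquality using (refl; sym; trans; cong; cong₂; module ≡-Reasoning)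
  open import Relation.Nullary using (yes; no)
  open Counting
  open ChipFiring

  -- The root's loop makes it its own parent.
  parent : Vertex k → Vertex k
  parent []      = []
  parent (_ ∷ u) = u

  received-root : ∀ v → received v [] ≡ 𝟙 (parent v ≟v [])
  received-root []          = refl
  received-root (_ ∷ [])    = refl
  received-root (_ ∷ _ ∷ _) = refl

  received-child : ∀ v j u → received v (j ∷ u) ≡ 𝟙 (v ≟v u) + 𝟙 (parent v ≟v (j ∷ u))
  received-child []      j []      = refl
  received-child []      j (_ ∷ _) = refl
  received-child (i ∷ p) j u with u ≟v (i ∷ p)
  ... | yes refl = sym (cong₂ _+_ (𝟙-yes ((i ∷ p) ≟v (i ∷ p)) refl)
                                  (𝟙-no (p ≟v (j ∷ i ∷ p)) (m≢1+n+m (length p) ∘ cong length)))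
  ... | no u≢ip rewrite 𝟙-no ((i ∷ p) ≟v u) (u≢ip ∘ sym) with p ≟v (j ∷ u)
  ...   | yes _ = refl
  ...   | no _  = refl

  children : Vertex k → List (Vertex k)
  children v = map (_∷ v) (allFin k)

  level : ℕ → List (Vertex k)
  level zero    = [ [] ]
  level (suc d) = concatMap children (level d)

  length-level : ∀ d → length (level d) ≡ k ^ d
  length-level zero    = refl
  length-level (suc d) = begin
    length (concatMap children (level d))  ≡⟨ length-concatMap children (level d) ⟩
    ∑[ p ∈ level d ] length (children p)   ≡⟨ ∑-cong (level d) length-children ⟩
    ∑[ p ∈ level d ] k                     ≡⟨ ∑-const (level d) k ⟩
    k * length (level d)                   ≡⟨ cong (k *_) (length-level d) ⟩
    k * k ^ d                              ∎
    where
    open ≡-Reasoning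
    length-children : ∀ p → length (children p) ≡ k
    length-children p = trans (length-map (_∷ p) (allFin k)) (length-tabulate id)

  mult-children-root : ∀ p → mult [] (children p) ≡ 0
  mult-children-root p = trans (∑-map (_∷ p) (allFin k) _) (∑-const (allFin k) 0)

  mult-children : ∀ p j u → mult (j ∷ u) (children p) ≡ 𝟙 (p ≟v u)
  mult-children p j u = begin
    mult (j ∷ u) (children p)                       ≡⟨ ∑-map (_∷ p) (allFin k) _ ⟩
    ∑[ i ∈ allFin k ] 𝟙 ((i ∷ p) ≟v (j ∷ u))        ≡⟨ ∑-cong (allFin k) (λ i → 𝟙-× (i Fin.≟ j) (p ≟v u)) ⟩
    ∑[ i ∈ allFin k ] (𝟙 (i Fin.≟ j) * 𝟙 (p ≟v u))  ≡⟨ ∑-*ʳ (allFin k) _ _ ⟩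
    (∑[ i ∈ allFin k ] 𝟙 (i Fin.≟ j)) * 𝟙 (p ≟v u)  ≡⟨ cong (_* 𝟙 (p ≟v u)) (∑-allFin-𝟙 j) ⟩
    1 * 𝟙 (p ≟v u)                                  ≡⟨ *-identityˡ _ ⟩
    𝟙 (p ≟v u)                                      ∎
    where open ≡-Reasoning

  mult-level : ∀ d w → mult w (level d) ≡ 𝟙 (length w ≟ d)
  mult-level zero    []      = refl
  mult-level zero    (_ ∷ _) = refl
  mult-level (suc d) []      = trans (∑-concatMap children (level d) _)
    (trans (∑-cong (level d) mult-children-root) (∑-const (level d) 0))
  mult-level (suc d) (j ∷ u) = trans (∑-concatMap children (level d) _)
    (trans (∑-cong (level d) (λ p → mult-children p j u)) (mult-level d u))

  ∑-parent-level : ∀ d w → ∑[ v ∈ level (suc d) ] 𝟙 (parent v ≟v w) ≡ mult w (level d) * k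
  ∑-parent-level d w = begin
    ∑[ v ∈ level (suc d) ] 𝟙 (parent v ≟v w)                   ≡⟨ ∑-concatMap children (level d) _ ⟩
    ∑[ p ∈ level d ] (∑[ v ∈ children p ] 𝟙 (parent v ≟v w))  ≡⟨ ∑-cong (level d) parents-of-children ⟩
    ∑[ p ∈ level d ] (𝟙 (p ≟v w) * k)                          ≡⟨ ∑-*ʳ (level d) _ k ⟩
    mult w (level d) * k                                       ∎
    where
    open ≡-Reasoning
    parents-of-children : ∀ p → ∑[ v ∈ children p ] 𝟙 (parent v ≟v w) ≡ 𝟙 (p ≟v w) * k
    parents-of-children p = trans (∑-map (_∷ p) (allFin k) _)
      (trans (∑-const (allFin k) _) (cong (𝟙 (p ≟v w) *_) (length-tabulate id)))

  -- The chips a vertex at depth e receives when every vertex at depth d fires once.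
  levelInflow : ℕ → ℕ → ℕ
  levelInflow zero    e = 𝟙 (e ≟ 1) + 𝟙 (e ≟ 0)
  levelInflow (suc d) e = 𝟙 (e ≟ suc (suc d)) + 𝟙 (e ≟ d) * k

  inflow-level : ∀ d w → inflow (level d) w ≡ levelInflow d (length w)
  inflow-level zero    []          = refl
  inflow-level zero    (_ ∷ [])    = refl
  inflow-level zero    (_ ∷ _ ∷ _) = refl
  inflow-level (suc d) []          = begin
    inflow (level (suc d)) []                  ≡⟨ ∑-cong (level (suc d)) received-root ⟩
    ∑[ v ∈ level (suc d) ] 𝟙 (parent v ≟v [])  ≡⟨ ∑-parent-level d [] ⟩
    mult [] (level d) * k                      ≡⟨ cong (_* k) (mult-level d []) ⟩
    𝟙 (0 ≟ d) * k                              ∎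
    where open ≡-Reasoning
  inflow-level (suc d) (j ∷ u)     = begin
    inflow (level (suc d)) (j ∷ u)
      ≡⟨ ∑-cong (level (suc d)) (λ v → received-child v j u) ⟩
    ∑[ v ∈ level (suc d) ] (𝟙 (v ≟v u) + 𝟙 (parent v ≟v (j ∷ u)))
      ≡⟨ ∑-+ (level (suc d)) _ _ ⟩
    mult u (level (suc d)) + (∑[ v ∈ level (suc d) ] 𝟙 (parent v ≟v (j ∷ u)))
      ≡⟨ cong₂ _+_ (mult-level (suc d) u) (∑-parent-level d (j ∷ u)) ⟩
    𝟙 (length u ≟ suc d) + mult (j ∷ u) (level d) * k
      ≡⟨ cong (λ m → 𝟙 (length u ≟ suc d) + m * k) (mult-level d (j ∷ u)) ⟩
    𝟙 (length u ≟ suc d) + 𝟙 (suc (length u) ≟ d) * k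
      ∎
    where open ≡-Reasoning

module Repunit where

  open import Data.Nat using (zero; suc; _+_; _*_; _∸_; _^_; _/_; s≤s)
  open import Data.Nat.DivMod using (m*n/n≡m)
  open import Data.Nat.Properties using (+-suc; *-comm; *-distribʳ-+; m+n∸n≡m)
  open import Data.Nat.Tactic.RingSolver using (solve-∀)
  open import Relation.Binary.PropositionalEquality using (refl; trans; cong; module ≡-Reasoning)

  repunit : ℕ → ℕ → ℕ
  repunit k zero    = 0
  repunit k (suc n) = suc (repunit k n * k)

  repunit-suc : ∀ k n → repunit k (suc n) ≡ k ^ n + repunit k n
  repunit-suc k zero    = refl
  repunit-suc k (suc n) = begin
    suc (repunit k (suc n) * k)        ≡⟨ cong (λ r → suc (r * k)) (repunit-suc k n) ⟩
    suc ((k ^ n + repunit k n) * k)    ≡⟨ cong suc (*-distribʳ-+ k (k ^ n) (repunit k n)) ⟩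
    suc (k ^ n * k + repunit k n * k)  ≡⟨ +-suc (k ^ n * k) _ ⟨
    k ^ n * k + repunit k (suc n)      ≡⟨ cong (_+ repunit k (suc n)) (*-comm (k ^ n) k) ⟩
    k * k ^ n + repunit k (suc n)      ∎
    where open ≡-Reasoning

  repunit-*-pred : ∀ k′ n → repunit (suc k′) n * k′ + 1 ≡ suc k′ ^ n
  repunit-*-pred k′ zero    = refl
  repunit-*-pred k′ (suc n) =
    trans (expand (repunit (suc k′) n) k′) (cong (suc k′ *_) (repunit-*-pred k′ n))
    where
    expand : ∀ r k′ → suc (r * suc k′) * k′ + 1 ≡ suc k′ * (r * k′ + 1)
    expand = solve-∀

  geomN≡repunit : ∀ k n (hk : 2 ≤ k) → geomN k n hk ≡ repunit k n
  geomN≡repunit (suc (suc k″)) n (s≤s (s≤s _)) = begin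
    (suc (suc k″) ^ n ∸ 1) / suc k″  ≡⟨ cong (λ m → (m ∸ 1) / suc k″) (repunit-*-pred (suc k″) n) ⟨
    (r * suc k″ + 1 ∸ 1) / suc k″    ≡⟨ cong (_/ suc k″) (m+n∸n≡m (r * suc k″) 1) ⟩
    r * suc k″ / suc k″              ≡⟨ m*n/n≡m r (suc k″) ⟩
    r                                ∎
    where
    open ≡-Reasoning
    r : ℕ
    r = repunit (suc (suc k″)) n

module LevelFiring (k : ℕ) where

  open import Data.List using ([]; _∷_; _++_; length)
  open import Data.List.Properties using (length-++)
  open import Data.Nat using (zero; suc; _+_; _*_; _∸_; _^_; z≤n; s≤s)
  open import Data.Nat.Properties
    using (_≟_; +-comm; +-assoc; +-suc; +-identityʳ; *-identityˡ; ≤-refl; <⇒≤; m≤m+n;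
           m∸n+n≡m; m+n∸m≡n; m+n∸n≡m; +-∸-assoc; +-cancelʳ-≡)
  open import Data.Product using (∃₂; _,_)
  open import Function using (_∘_)
  open import Relation.Binary.PropositionalEquality
    using (_≗_; refl; sym; trans; cong; cong₂; subst; subst₂; module ≡-Reasoning)
  open Counting
  open ChipFiring
  open Levels k
  open Repunit

  Profile : Set
  Profile = ℕ → ℕ

  infixr 5 _◃_
  _◃_ : ℕ → Profile → Profile
  (x ◃ a) zero    = x
  (x ◃ a) (suc e) = a e

  HasProfile : Config k → Profile → Set
  HasProfile c a = ∀ v → c v ≡ a (length v)

  -- Only k chips leave the root: the one it sends along its loop comes back.
  fireLevel : ℕ → Profile → Profile
  fireLevel zero          a = (a 0 ∸ k) ◃ suc (a 1) ◃ (a ∘ suc ∘ suc)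
  fireLevel (suc zero)    a = (a 0 + k) ◃ (a 1 ∸ suc k) ◃ suc (a 2) ◃ (a ∘ suc ∘ suc ∘ suc)
  fireLevel (suc (suc d)) a = a 0 ◃ fireLevel (suc d) (a ∘ suc)

  fireLevel-balance : ∀ d {a} → suc k ≤ a d → ∀ e →
                      fireLevel d a e + 𝟙 (e ≟ d) * suc k ≡ a e + levelInflow d e
  fireLevel-balance zero {a} h zero = begin
    a 0 ∸ k + 1 * suc k  ≡⟨ cong (a 0 ∸ k +_) (*-identityˡ (suc k)) ⟩
    a 0 ∸ k + suc k      ≡⟨ +-suc (a 0 ∸ k) k ⟩
    suc (a 0 ∸ k + k)    ≡⟨ cong suc (m∸n+n≡m (<⇒≤ h)) ⟩
    suc (a 0)            ≡⟨ +-comm 1 (a 0) ⟩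
    a 0 + 1              ∎
    where open ≡-Reasoning
  fireLevel-balance zero       {a} h (suc zero)          = trans (+-identityʳ _) (+-comm 1 (a 1))
  fireLevel-balance zero           h (suc (suc e))       = refl
  fireLevel-balance (suc zero) {a} h zero                = +-assoc (a 0) k 0
  fireLevel-balance (suc zero) {a} h (suc zero)          =
    trans (cong (a 1 ∸ suc k +_) (*-identityˡ (suc k))) (trans (m∸n+n≡m h) (sym (+-identityʳ _)))
  fireLevel-balance (suc zero) {a} h (suc (suc zero))    = trans (+-identityʳ _) (+-comm 1 (a 2))
  fireLevel-balance (suc zero)     h (suc (suc (suc e))) = refl
  fireLevel-balance (suc (suc d))  h zero                = refl
  fireLevel-balance (suc (suc d))  h (suc e)             = fireLevel-balance (suc d) h e

  infix 4 _⟶[_]_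
  record _⟶[_]_ (a : Profile) (t : ℕ) (b : Profile) : Set where
    field run : ∀ {c} → HasProfile c a → ∃₂ λ vs c′ → Legal c vs c′ × HasProfile c′ b × length vs ≡ t
  open _⟶[_]_ public

  ⟶-cast : ∀ {a b s t} → s ≡ t → a ⟶[ s ] b → a ⟶[ t ] b
  ⟶-cast refl a⟶b = a⟶b

  module ⟶-Reasoning where

    infixr 2 _⟶⟨_⟩_ _≗⟨_⟩_ _≡⟨_⟩_
    infix 3 _∎

    _⟶⟨_⟩_ : ∀ a {s b t c} → a ⟶[ s ] b → b ⟶[ t ] c → a ⟶[ s + t ] c
    run (a ⟶⟨ a⟶b ⟩ b⟶c) ha =
      let vs , c₁ , L₁ , h₁ , len₁ = run a⟶b ha
          ws , c₂ , L₂ , h₂ , len₂ = run b⟶c h₁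
      in vs ++ ws , c₂ , Legal-++ L₁ L₂ , h₂ , trans (length-++ vs) (cong₂ _+_ len₁ len₂)

    _≗⟨_⟩_ : ∀ a {b t c} → a ≗ b → b ⟶[ t ] c → a ⟶[ t ] c
    run (a ≗⟨ a≗b ⟩ b⟶c) ha = run b⟶c (λ v → trans (ha v) (a≗b (length v)))

    _≡⟨_⟩_ : ∀ a {b t c} → a ≡ b → b ⟶[ t ] c → a ⟶[ t ] c
    a ≡⟨ refl ⟩ b⟶c = b⟶c

    _∎ : ∀ a → a ⟶[ 0 ] a
    run (a ∎) {c} ha = [] , c , done , ha , refl

  fireLevel-legal : ∀ d {a} → suc k ≤ a d → a ⟶[ k ^ d ] fireLevel d a
  run (fireLevel-legal d {a} h) {c} hc =
    let c′ , L = legal-of-enough-chips (level d) enough in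
    level d , c′ , L , profile L , length-level d
    where
    enough : ∀ w → mult w (level d) * suc k ≤ c w
    enough w = subst₂ _≤_ (cong (_* suc k) (sym (mult-level d w))) (sym (hc w))
                          (𝟙-*-≤ (length w ≟ d) (λ |w|≡d → subst (λ e → suc k ≤ a e) (sym |w|≡d) h))

    profile : ∀ {c′} → Legal c (level d) c′ → HasProfile c′ (fireLevel d a)
    profile {c′} L w = +-cancelʳ-≡ (𝟙 (length w ≟ d) * suc k) _ _ (begin
      c′ w + 𝟙 (length w ≟ d) * suc k
        ≡⟨ cong (λ m → c′ w + m * suc k) (mult-level d w) ⟨
      c′ w + mult w (level d) * suc k
        ≡⟨ balance (legal-balance L) w ⟩
      c w + inflow (level d) w
        ≡⟨ cong₂ _+_ (hc w) (inflow-level d w) ⟩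
      a (length w) + levelInflow d (length w)
        ≡⟨ fireLevel-balance d h (length w) ⟨
      fireLevel d a (length w) + 𝟙 (length w ≟ d) * suc k
        ∎)
      where open ≡-Reasoning

  zeros : Profile
  zeros _ = 0

  zeros≗0◃zeros : zeros ≗ 0 ◃ zeros
  zeros≗0◃zeros zero    = refl
  zeros≗0◃zeros (suc _) = refl

  ◃-cong : ∀ x {a b} → a ≗ b → x ◃ a ≗ x ◃ b
  ◃-cong x a≗b zero    = refl
  ◃-cong x a≗b (suc e) = a≗b e

  initial-profile : ∀ {N M} → N ≡ M → HasProfile (initial k N) (M ◃ zeros)
  initial-profile N≡M []      = N≡M
  initial-profile N≡M (_ ∷ _) = refl

  ones : ℕ → Profile → Profile
  ones zero    a = a
  ones (suc p) a = 1 ◃ ones p a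

  ones-snoc : ∀ p {a} → ones p (1 ◃ a) ≡ ones (suc p) a
  ones-snoc zero    = refl
  ones-snoc (suc p) = cong (1 ◃_) (ones-snoc p)

  ones-at : ∀ p {a} → ones p a p ≡ a 0
  ones-at zero    = refl
  ones-at (suc p) = ones-at p

  ones-cong : ∀ p {a b} → a ≗ b → ones p a ≗ ones p b
  ones-cong zero    a≗b         = a≗b
  ones-cong (suc p) a≗b zero    = refl
  ones-cong (suc p) a≗b (suc e) = ones-cong p a≗b e

  ones-zeros≤1 : ∀ p e → ones p zeros e ≤ 1
  ones-zeros≤1 zero    e       = z≤n
  ones-zeros≤1 (suc p) zero    = s≤s z≤n
  ones-zeros≤1 (suc p) (suc e) = ones-zeros≤1 p e

  fireLevel-ones : ∀ j a → fireLevel (suc j) (ones (suc j) a) ≡ ones j (fireLevel 1 (1 ◃ a))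
  fireLevel-ones zero    a = refl
  fireLevel-ones (suc j) a = cong (1 ◃_) (fireLevel-ones j a)

  wave : ∀ p {N x g} → suc k ≤ N →
         ones p (N ◃ x ◃ g) ⟶[ repunit k (suc p) ] ones p ((N ∸ k) ◃ suc x ◃ g)
  wave zero                h       = fireLevel-legal 0 h
  wave (suc j) {N} {x} {g} (s≤s h) = ⟶-cast count (
    ones (suc j) (N ◃ x ◃ g)
      ⟶⟨ fireLevel-legal (suc j) (subst (suc k ≤_) (sym (ones-at (suc j))) (s≤s h)) ⟩
    fireLevel (suc j) (ones (suc j) (N ◃ x ◃ g))
      ≡⟨ fireLevel-ones j _ ⟩
    ones j (suc k ◃ (N ∸ suc k) ◃ suc x ◃ g)
      ⟶⟨ wave j ≤-refl ⟩
    ones j ((suc k ∸ k) ◃ suc (N ∸ suc k) ◃ suc x ◃ g)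
      ≡⟨ cong₂ (λ y z → ones j (y ◃ z ◃ suc x ◃ g)) (m+n∸n≡m 1 k) (sym (+-∸-assoc 1 h)) ⟩
    ones j (1 ◃ (N ∸ k) ◃ suc x ◃ g)
      ≡⟨ ones-snoc j ⟩
    ones (suc j) ((N ∸ k) ◃ suc x ◃ g)
      ∎)
    where
    open ⟶-Reasoning
    count : k ^ suc j + (repunit k (suc j) + 0) ≡ repunit k (suc (suc j))
    count = trans (cong (k ^ suc j +_) (+-identityʳ _)) (sym (repunit-suc k (suc j)))

  waves : ∀ p r {x g} →
          ones p ((1 + r * k) ◃ x ◃ g) ⟶[ r * repunit k (suc p) ] ones p (1 ◃ (r + x) ◃ g)
  waves p zero    {x} {g} = ones p (1 ◃ x ◃ g) ∎
    where open ⟶-Reasoning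
  waves p (suc r) {x} {g} = ⟶-cast (cong (repunit k (suc p) +_) (+-identityʳ _)) (
    ones p ((1 + suc r * k) ◃ x ◃ g)
      ⟶⟨ wave p (s≤s k≤) ⟩
    ones p ((suc (k + r * k) ∸ k) ◃ suc x ◃ g)
      ≡⟨ cong (λ y → ones p (y ◃ suc x ◃ g)) (trans (+-∸-assoc 1 k≤) (cong suc (m+n∸m≡n k (r * k)))) ⟩
    ones p ((1 + r * k) ◃ suc x ◃ g)
      ⟶⟨ waves p r ⟩
    ones p (1 ◃ (r + suc x) ◃ g)
      ≡⟨ cong (λ y → ones p (1 ◃ y ◃ g)) (+-suc r x) ⟩
    ones p (1 ◃ (suc r + x) ◃ g)
      ∎)
    where
    open ⟶-Reasoning
    k≤ : k ≤ k + r * k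
    k≤ = m≤m+n k (r * k)

  spreadLength : ℕ → ℕ → ℕ
  spreadLength zero    p = 0
  spreadLength (suc j) p = repunit k j * repunit k (suc p) + spreadLength j (suc p)

  spread : ∀ j p → ones p (repunit k j ◃ zeros) ⟶[ spreadLength j p ] ones (j + p) zeros
  spread zero    p =
    ones p (0 ◃ zeros)  ≗⟨ ones-cong p (sym ∘ zeros≗0◃zeros) ⟩
    ones p zeros        ∎
    where open ⟶-Reasoning
  spread (suc j) p = ⟶-cast (cong (repunit k j * repunit k (suc p) +_) (+-identityʳ _)) (
    ones p (repunit k (suc j) ◃ zeros)
      ≗⟨ ones-cong p (◃-cong _ zeros≗0◃zeros) ⟩
    ones p ((1 + repunit k j * k) ◃ 0 ◃ zeros)
      ⟶⟨ waves p (repunit k j) ⟩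
    ones p (1 ◃ (repunit k j + 0) ◃ zeros)
      ≡⟨ trans (cong (λ y → ones p (1 ◃ y ◃ zeros)) (+-identityʳ _)) (ones-snoc p) ⟩
    ones (suc p) (repunit k j ◃ zeros)
      ⟶⟨ spread j (suc p) ⟩
    ones (j + suc p) zeros
      ≡⟨ cong (λ q → ones q zeros) (+-suc j p) ⟩
    ones (suc j + p) zeros
      ∎)
    where open ⟶-Reasoning

open ChipFiring using (stabilising-runs-have-equal-length)
open Repunit using (repunit; geomN≡repunit)
open LevelFiring using (run; spread; spreadLength; initial-profile; ones-zeros≤1)

import Data.Nat as ℕ
open import Data.Integer using (ℤ; +_; _-_; _*_; _+_; _^_)
open import Data.Integer.Properties using (pos-*)
open import Data.Integer.Tactic.RingSolver using (solve-∀)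
open import Data.List using (length)
open import Data.Nat.Properties using (≤-trans; ≤-reflexive)
open import Data.Product using (_,_)
open import Relation.Binary.PropositionalEquality using (refl; trans; cong; cong₂; module ≡-Reasoning)

repunit-ℤ : ∀ k n → (+ k - + 1) * + repunit k n ≡ (+ k) ^ n - + 1
repunit-ℤ k ℕ.zero    = times-zero (+ k)
  where
  times-zero : ∀ K → (K - + 1) * + 0 ≡ + 1 - + 1
  times-zero = solve-∀
repunit-ℤ k (ℕ.suc n) = begin
  (K - + 1) * (+ 1 + + (repunit k n ℕ.* k))  ≡⟨ cong (λ x → (K - + 1) * (+ 1 + x)) (pos-* (repunit k n) k) ⟩
  (K - + 1) * (+ 1 + + repunit k n * K)      ≡⟨ expand K (+ repunit k n) ⟩
  (K - + 1) + (K - + 1) * + repunit k n * K  ≡⟨ cong (λ x → (K - + 1) + x * K) (repunit-ℤ k n) ⟩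
  (K - + 1) + (K ^ n - + 1) * K              ≡⟨ collect K (K ^ n) ⟩
  K * K ^ n - + 1                            ∎
  where
  open ≡-Reasoning
  K : ℤ
  K = + k
  expand : ∀ K R → (K - + 1) * (+ 1 + R * K) ≡ (K - + 1) + (K - + 1) * R * K
  expand = solve-∀
  collect : ∀ K A → (K - + 1) + (A - + 1) * K ≡ K * A - + 1
  collect = solve-∀

-- The cube (K - 1) ^ 3 is written out as the product it unfolds to, which the ring solver accepts.
spreadLength-closed-form : ∀ k j p →
  (+ k - + 1) ^ 3 * + spreadLength k j p ≡
  (+ k - + 1) * + j * ((+ k) ^ j * (+ k) ^ p + + 1) - ((+ k) ^ j - + 1) * (+ k * (+ k) ^ p + + 1)
spreadLength-closed-form k ℕ.zero    p = empty (+ k) ((+ k) ^ p)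
  where
  empty : ∀ K B → (K - + 1) * ((K - + 1) * ((K - + 1) * + 1)) * + 0
                ≡ (K - + 1) * + 0 * (+ 1 * B + + 1) - (+ 1 - + 1) * (K * B + + 1)
  empty = solve-∀
spreadLength-closed-form k (ℕ.suc j) p = begin
  (K - + 1) ^ 3 * + (ρ j ℕ.* ρ (ℕ.suc p) ℕ.+ S)
    ≡⟨ cong (λ x → (K - + 1) ^ 3 * (x + + S)) (pos-* (ρ j) (ρ (ℕ.suc p))) ⟩
  (K - + 1) ^ 3 * (+ ρ j * + ρ (ℕ.suc p) + + S)
    ≡⟨ distribute K (+ ρ j) (+ ρ (ℕ.suc p)) (+ S) ⟩
  ((K - + 1) * + ρ j) * ((K - + 1) * + ρ (ℕ.suc p)) * (K - + 1) + (K - + 1) ^ 3 * + S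
    ≡⟨ cong₂ (λ x y → x * y * (K - + 1) + (K - + 1) ^ 3 * + S) (repunit-ℤ k j) (repunit-ℤ k (ℕ.suc p)) ⟩
  (K ^ j - + 1) * (K * K ^ p - + 1) * (K - + 1) + (K - + 1) ^ 3 * + S
    ≡⟨ cong (λ x → (K ^ j - + 1) * (K * K ^ p - + 1) * (K - + 1) + x) (spreadLength-closed-form k j _) ⟩
  (K ^ j - + 1) * (K * K ^ p - + 1) * (K - + 1)
    + ((K - + 1) * + j * (K ^ j * (K * K ^ p) + + 1) - (K ^ j - + 1) * (K * (K * K ^ p) + + 1))
    ≡⟨ collect K (K ^ j) (K ^ p) (+ j) ⟩
  (K - + 1) * (+ 1 + + j) * (K * K ^ j * K ^ p + + 1) - (K * K ^ j - + 1) * (K * K ^ p + + 1)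
    ∎
  where
  open ≡-Reasoning
  K : ℤ
  K = + k
  ρ : ℕ → ℕ
  ρ = repunit k
  S : ℕ
  S = spreadLength k j (ℕ.suc p)
  distribute : ∀ K X Y Z → (K - + 1) * ((K - + 1) * ((K - + 1) * + 1)) * (X * Y + Z)
    ≡ ((K - + 1) * X) * ((K - + 1) * Y) * (K - + 1) + (K - + 1) * ((K - + 1) * ((K - + 1) * + 1)) * Z
  distribute = solve-∀
  collect : ∀ K A B J →
    (A - + 1) * (K * B - + 1) * (K - + 1) + ((K - + 1) * J * (A * (K * B) + + 1) - (A - + 1) * (K * (K * B) + + 1))
    ≡ (K - + 1) * (+ 1 + J) * (K * A * B + + 1) - (K * A - + 1) * (K * B + + 1)
  collect = solve-∀

mainTheorem12 : (k n : ℕ) → (hk : 2 ≤ k) → 1 ≤ n →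
    Σ ℕ (λ F → CompleteRun k (geomN k n hk) F ×
      ((t : ℕ) → CompleteRun k (geomN k n hk) t → t ≡ F) ×
      ((+ k - + 1) ^ 3 * + F ≡ ((+ k * (+ n - + 1) - + n - + 1) * (+ k) ^ n + + k * (+ n + + 1) - + n + + 1)))
mainTheorem12 k n hk _
  with vs , c , L , spread-profile , len ← run (spread k n 0) (initial-profile k (geomN≡repunit k n hk)) =
  spreadLength k n 0 , (vs , c , L , stable , len) , unique , closed-form
  where
  stable : Stable c
  stable v = ℕ.s≤s (≤-trans (≤-reflexive (spread-profile v))
                   (≤-trans (ones-zeros≤1 k (n ℕ.+ 0) (length v)) (≤-trans (ℕ.s≤s ℕ.z≤n) hk)))
  unique : ∀ t → CompleteRun k (geomN k n hk) t → t ≡ spreadLength k n 0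
  unique t (α , c′ , Lα , Sα , refl) = trans (stabilising-runs-have-equal-length Lα Sα L stable) len
  at-root : ∀ K N A → (K - + 1) * N * (A * + 1 + + 1) - (A - + 1) * (K * + 1 + + 1)
                    ≡ (K * (N - + 1) - N - + 1) * A + K * (N + + 1) - N + + 1
  at-root = solve-∀
  closed-form : (+ k - + 1) ^ 3 * + spreadLength k n 0
              ≡ (+ k * (+ n - + 1) - + n - + 1) * (+ k) ^ n + + k * (+ n + + 1) - + n + + 1
  closed-form = trans (spreadLength-closed-form k n 0) (at-root (+ k) (+ n) ((+ k) ^ n))
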